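{- Let $f:\{\pm1\}^n\to\{\pm1\}$ be computable by a size-$s$ decision tree $T$ and let $\tau > 0$. There is a pruning $T^\star$ of $T$ satisfying: (i) $\Pr_{\boldsymbol{x}}[f(\boldsymbol{x}) \neq T^\star(\boldsymbol{x})] \le \tau \log s$, with $\boldsymbol{x}$ uniform over $\{\pm1\}^n$; (ii) for every internal node $v$ of $T^\star$, writing $i(v)$ for the variable queried at $v$, we have $\mathrm{Inf}_{i(v)}(f_v) \ge \tau$, where $f_v$ denotes the restriction of $f$ by the root-to-$v$ path in $T^\star$.
   Context: A decision tree over $\{\pm1\}^n$ is a binary tree whose internal nodes query a variable and branch on its value; its size is its number of leaves. A pruning of $T$ is any tree obtained from $T$ by iteratively replacing some internal node (together with its subtree) by one of that node's two child subtrees. For $g:\{\pm1\}^n\to\{\pm1\}$ and $i\in[n]$, $\mathrm{Inf}_i(g) = \Pr_{\boldsymbol{x}}[g(\boldsymbol{x}) \neq g(\boldsymbol{x}^{i})]$, where $\boldsymbol{x}$ is uniform over $\{\pm1\}^n$ and $\boldsymbol{x}^{i}$ is $\boldsymbol{x}$ with its $i$-th coordinate rerandomized (independently set uniformly at random). The restriction of $f$ by a root-to-$v$ path is the function obtained by fixing the variables queried along the path to the values on that path. $\log$ is base 2.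
   Formalization: The parameter τ ranges over the positive rationals. -}

module Defs where

open import Data.Bool using (Bool; true; false; if_then_else_; _xor_)
open import Data.Nat using (ℕ; zero; suc; _+_; _*_; _^_; _≤_)
open import Data.Nat.Properties using (m^n≢0)
open import Data.Fin using (Fin; zero; suc; _≟_)
open import Data.Integer using (ℤ; +_; ∣_∣)
open import Data.Rational using (ℚ; _/_; ↥_; ↧ₙ_) renaming (_≤_ to _≤ℚ_)
open import Data.Product using (_×_)
open import Data.Unit using (⊤)
open import Data.Vec.Functional using (_∷_)
open import Relation.Nullary using (does)
open import Relation.Binary.Construct.Closure.ReflexiveTransitive using (Star)

-- Points of {±1}^n, encoded as Fin n → Bool  (true = +1, false = -1).
Point : ℕ → Set
Point n = Fin n → Bool

data DT (n : ℕ) : Set where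
  leaf : Bool → DT n
  node : Fin n → DT n → DT n → DT n

size : ∀ {n} → DT n → ℕ
size (leaf _)     = 1
size (node _ l r) = size l + size r

eval : ∀ {n} → DT n → Point n → Bool
eval (leaf b)     x = b
eval (node i l r) x = if x i then eval r x else eval l x

data PruneStep {n : ℕ} : DT n → DT n → Set where
  toLeft  : ∀ i l r → PruneStep (node i l r) l
  toRight : ∀ i l r → PruneStep (node i l r) r
  inLeft  : ∀ i {l l′} r → PruneStep l l′ → PruneStep (node i l r) (node i l′ r)
  inRight : ∀ i l {r r′} → PruneStep r r′ → PruneStep (node i l r) (node i l r′)

IsPruning : ∀ {n} → DT n → DT n → Set
IsPruning T T′ = Star PruneStep T T′

set : ∀ {n} → Fin n → Bool → Point n → Point n
set i b x j = if does (j ≟ i) then b else x j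

count : ∀ {n} → (Point n → Bool) → ℕ
count {zero}  p = if p (λ ()) then 1 else 0
count {suc n} p = count (λ x → p (false ∷ x)) + count (λ x → p (true ∷ x))

-- Pr_x[f x ≠ g x] = disagree f g / 2^n
disagree : ∀ {n} → (Point n → Bool) → (Point n → Bool) → ℕ
disagree f g = count (λ x → f x xor g x)

-- Inf_i(g) = Pr_{x, b}[g x ≠ g (x with x_i := b)],  x and b uniform
-- (rerandomization of coordinate i), over 2^(n+1) equally likely outcomes.
Inf : ∀ {n} → (Point n → Bool) → Fin n → ℚ
Inf {n} g i =
  _/_ (+ (count (λ x → g x xor g (set i false x))
        + count (λ x → g x xor g (set i true x))))
      (2 ^ suc n) {{m^n≢0 2 (suc n)}}

-- Condition (ii): for every internal node v of the tree, Inf_{i(v)}(f_v) ≥ τ,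
-- where ρ is the restriction accumulated along the root-to-v path
-- (f_v = f ∘ ρ; variables fixed higher up on the path take precedence).
InfAbove : ∀ {n} → ℚ → (Point n → Bool) → (Point n → Point n) → DT n → Set
InfAbove τ f ρ (leaf _)     = ⊤
InfAbove τ f ρ (node i l r) =
  (τ ≤ℚ Inf (λ x → f (ρ x)) i)
  × InfAbove τ f (λ x → ρ (set i false x)) l
  × InfAbove τ f (λ x → ρ (set i true  x)) r

-- Condition (i):  e / 2^n ≤ τ · log₂ s,  for τ = a/b > 0 (a = ↥τ, b = ↧τ).
-- Since everything is nonnegative this is equivalent to
--   e·b / (2^n·a) ≤ log₂ s   ⇔   2^(e·b) ≤ s^(2^n·a),
-- which is stated exactly in ℕ (log₂ s is irrational in general).
ErrorAtMostTauLog : (n e : ℕ) → ℚ → ℕ → Set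
ErrorAtMostTauLog n e τ s = 2 ^ (e * ↧ₙ τ) ≤ s ^ (2 ^ n * ∣ ↥ τ ∣)

-- T is first pruned so that no variable is queried twice on a path, which does not change the function.
-- Then T⋆ is built top-down: at a node querying i, with g the restriction of f along the path, keep
-- the node and recurse on both restrictions g|xᵢ=b if Infᵢ(g) ≥ τ; otherwise replace the node by one
-- of its children and recurse on g itself.  By induction on T,
--     err(g, T⋆) ≤ err(g, T) + τ·log(size T).
-- At a kept node err(g, ·) is the average of the children's errors, and log s₀ + log s₁ ≤ 2 log(s₀ + s₁).
-- At a replaced node, err(g, child_b) ≤ Pr[g ≠ g|xᵢ=b] + err(g|xᵢ=b, child_b); the first terms sum to
-- 2 Infᵢ(g) < 2τ and the second ones to 2 err(g, node), so by AM-GM, 4 s₀ s₁ ≤ (s₀ + s₁)², one of the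
-- two children satisfies the bound.

{-# OPTIONS --safe #-}
module Submission where

open import Defs

import Algebra.Properties.CommutativeSemigroup as CommSemigroupProperties
open import Data.Bool using (Bool; true; false; if_then_else_; _xor_)
open import Data.Bool.Properties using (xor-same)
open import Data.Fin using (Fin; zero; suc; _≟_)
open import Data.Integer as ℤ using (+_; ∣_∣)
import Data.Integer.Properties as ℤ
open import Data.Nat using (ℕ; zero; suc; _+_; _*_; _^_; _≤_; _<_; z≤n; s≤s; NonZero)
open import Data.Nat.Properties
  using ( ≤-refl; ≤-trans; ≤-reflexive; ≤-total; <⇒≤; ≰⇒>; <⇒≱; _≤?_; m≤m+n; m≤n+m; m≤n⇒∃[o]m+o≡n
        ; +-comm; +-mono-≤; +-monoˡ-≤; +-monoʳ-≤; *-comm; *-assoc; *-identityˡ; *-identityʳ; *-distribʳ-+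
        ; *-mono-≤; *-monoˡ-≤; *-monoʳ-≤; *-mono-<
        ; ^-distribˡ-+-*; ^-*-assoc; ^-zeroˡ; m^n≢0; ^-monoˡ-≤; ^-monoʳ-≤
        ; +-commutativeSemigroup; *-commutativeSemigroup; module ≤-Reasoning )
open import Data.Nat.Tactic.RingSolver using (solve-∀)
open import Data.Product using (Σ; _×_; _,_)
open import Data.Rational using (ℚ; mkℚ; Positive; _/_; ↥_; ↧ₙ_) renaming (_≤_ to _≤ℚ_; _<_ to _<ℚ_)
open import Data.Rational.Properties using (toℚᵘ-mono-<; toℚᵘ-fromℚᵘ)
  renaming (_≤?_ to _≤ℚ?_; ≰⇒> to ≰⇒>ℚ)
open import Data.Rational.Unnormalised using (mkℚᵘ)
import Data.Rational.Unnormalised.Properties as ℚᵘ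
open import Data.Sum using (_⊎_; inj₁; inj₂; [_,_]′)
open import Data.Unit using (⊤; tt)
open import Data.Vec.Functional using (_∷_)
open import Function using (id; _∘_)
open import Relation.Binary.Core using (_Preserves_⟶_)
open import Relation.Binary.Construct.Closure.ReflexiveTransitive using (ε; _◅_; _◅◅_; gmap)
open import Relation.Binary.PropositionalEquality
open import Relation.Nullary using (yes; no; contradiction)
open import Relation.Nullary.Decidable using (dec-true; dec-false)

open CommSemigroupProperties +-commutativeSemigroup using () renaming (interchange to +-interchange)
open CommSemigroupProperties *-commutativeSemigroup using ()
  renaming (interchange to *-interchange; xy∙z≈y∙xz to *-xy∙z≈y∙xz)

^-distribʳ-* : ∀ m n k → (m * n) ^ k ≡ m ^ k * n ^ k
^-distribʳ-* m n zero    = refl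
^-distribʳ-* m n (suc k) = trans (cong ((m * n) *_) (^-distribʳ-* m n k)) (*-interchange m n (m ^ k) (n ^ k))

m*n≤o*o⇒m≤o⊎n≤o : ∀ {m n o} → m * n ≤ o * o → m ≤ o ⊎ n ≤ o
m*n≤o*o⇒m≤o⊎n≤o {m} {n} {o} mn≤oo with m ≤? o | n ≤? o
... | yes m≤o | _       = inj₁ m≤o
... | no _    | yes n≤o = inj₂ n≤o
... | no m≰o  | no n≰o  = contradiction mn≤oo (<⇒≱ (*-mono-< (≰⇒> m≰o) (≰⇒> n≰o)))

m*m≤n*n⇒m≤n : ∀ {m n} → m * m ≤ n * n → m ≤ n
m*m≤n*n⇒m≤n = [ id , id ]′ ∘ m*n≤o*o⇒m≤o⊎n≤o

am-gm : ∀ m n → 4 * (m * n) ≤ (m + n) * (m + n)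
am-gm m n = [ am-gm-≤ , (λ n≤m → subst₂ _≤_ (cong (4 *_) (*-comm n m)) (cong (λ s → s * s) (+-comm n m))
                                                (am-gm-≤ n≤m)) ]′ (≤-total m n)
  where
  am-gm-≤ : ∀ {m n} → m ≤ n → 4 * (m * n) ≤ (m + n) * (m + n)
  am-gm-≤ {m} m≤n with k , refl ← m≤n⇒∃[o]m+o≡n m≤n =
    ≤-trans (m≤m+n _ (k * k)) (≤-reflexive (square-expansion m k))
    where
    square-expansion : ∀ m k → 4 * (m * (m + k)) + k * k ≡ (m + (m + k)) * (m + (m + k))
    square-expansion = solve-∀

+m/n<p⇒m*↧p<∣↥p∣*n : ∀ {p : ℚ} .{{_ : Positive p}} m n .{{_ : NonZero n}} →
                     (+ m / n) <ℚ p → m * ↧ₙ p < ∣ ↥ p ∣ * n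
+m/n<p⇒m*↧p<∣↥p∣*n {mkℚ (+ a) _ _} m (suc d) m/n<p =
  ℤ.drop‿+<+ (subst₂ ℤ._<_ (sym (ℤ.pos-* m _)) (sym (ℤ.pos-* a _))
    (ℚᵘ.drop-*<* (ℚᵘ.<-respˡ-≃ (toℚᵘ-fromℚᵘ (mkℚᵘ (+ m) d)) (toℚᵘ-mono-< m/n<p))))

-- Without function extensionality, reindexing a count needs predicates respecting pointwise equality.
Extensional : ∀ {n} → (Point n → Bool) → Set
Extensional g = g Preserves _≗_ ⟶ _≡_

set-≡ : ∀ {n} (i : Fin n) b (x : Point n) → set i b x i ≡ b
set-≡ i b x rewrite dec-true (i ≟ i) refl = refl

set-≢ : ∀ {n} {i j : Fin n} b (x : Point n) → j ≢ i → set i b x j ≡ x j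
set-≢ {i = i} {j} b x j≢i rewrite dec-false (j ≟ i) j≢i = refl

set-cong : ∀ {n} (i : Fin n) b {x y : Point n} → x ≗ y → set i b x ≗ set i b y
set-cong i b x≗y j with j ≟ i
... | yes _ = refl
... | no _  = x≗y j

set-self : ∀ {n} (i : Fin n) {b} {x : Point n} → x i ≡ b → set i b x ≗ x
set-self i refl j with j ≟ i
... | yes refl = refl
... | no _     = refl

∘set-extensional : ∀ {n} {g : Point n → Bool} → Extensional g → ∀ i b → Extensional (g ∘ set i b)
∘set-extensional E i b x≗y = E (set-cong i b x≗y)

∘∷-extensional : ∀ {n} {g : Point (suc n) → Bool} → Extensional g → ∀ c → Extensional (g ∘ (c ∷_))
∘∷-extensional E c x≗y = E λ { zero → refl ; (suc j) → x≗y j }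

xor-extensional : ∀ {n} {f g : Point n → Bool} → Extensional f → Extensional g →
                  Extensional (λ x → f x xor g x)
xor-extensional Ef Eg x≗y = cong₂ _xor_ (Ef x≗y) (Eg x≗y)

count-cong : ∀ {n} {p q : Point n → Bool} → p ≗ q → count p ≡ count q
count-cong {zero}  p≗q = cong (λ b → if b then 1 else 0) (p≗q _)
count-cong {suc n} p≗q = cong₂ _+_ (count-cong (p≗q ∘ (false ∷_))) (count-cong (p≗q ∘ (true ∷_)))

count-set-split : ∀ {n} {p : Point n → Bool} → Extensional p → ∀ i →
                  count (p ∘ set i false) + count (p ∘ set i true) ≡ count p + count p
count-set-split {suc n} {p} E zero = trans
  (cong₂ _+_ (cong₂ _+_ (overwrite false false) (overwrite false true))
             (cong₂ _+_ (overwrite true false) (overwrite true true)))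
  (+-interchange (count (p ∘ (false ∷_))) _ (count (p ∘ (true ∷_))) _)
  where
  overwrite : ∀ b c → count (p ∘ set zero b ∘ (c ∷_)) ≡ count (p ∘ (b ∷_))
  overwrite b c = count-cong λ x → E {set zero b (c ∷ x)} {b ∷ x} λ { zero → refl ; (suc j) → refl }
count-set-split {suc n} {p} E (suc i) = begin
  (count (p ∘ set (suc i) false ∘ (false ∷_)) + count (p ∘ set (suc i) false ∘ (true ∷_))) +
  (count (p ∘ set (suc i) true ∘ (false ∷_)) + count (p ∘ set (suc i) true ∘ (true ∷_)))
    ≡⟨ +-interchange (count (p ∘ set (suc i) false ∘ (false ∷_))) _ _ _ ⟩
  (count (p ∘ set (suc i) false ∘ (false ∷_)) + count (p ∘ set (suc i) true ∘ (false ∷_))) +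
  (count (p ∘ set (suc i) false ∘ (true ∷_)) + count (p ∘ set (suc i) true ∘ (true ∷_)))
    ≡⟨ cong₂ _+_ (split-below false) (split-below true) ⟩
  (count (p ∘ (false ∷_)) + count (p ∘ (false ∷_))) + (count (p ∘ (true ∷_)) + count (p ∘ (true ∷_)))
    ≡⟨ +-interchange (count (p ∘ (false ∷_))) _ (count (p ∘ (true ∷_))) _ ⟩
  count p + count p ∎
  where
  open ≡-Reasoning
  commute : ∀ b c → count (p ∘ set (suc i) b ∘ (c ∷_)) ≡ count (p ∘ (c ∷_) ∘ set i b)
  commute b c = count-cong λ x → E {set (suc i) b (c ∷ x)} {c ∷ set i b x} λ { zero → refl ; (suc j) → refl }
  split-below : ∀ c → count (p ∘ set (suc i) false ∘ (c ∷_)) + count (p ∘ set (suc i) true ∘ (c ∷_))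
                      ≡ count (p ∘ (c ∷_)) + count (p ∘ (c ∷_))
  split-below c = trans (cong₂ _+_ (commute false c) (commute true c))
                        (count-set-split (∘∷-extensional E c) i)

disagree-self : ∀ {n} (f : Point n → Bool) → disagree f f ≡ 0
disagree-self {zero}  f = cong (λ b → if b then 1 else 0) (xor-same (f _))
disagree-self {suc n} f = cong₂ _+_ (disagree-self (f ∘ (false ∷_))) (disagree-self (f ∘ (true ∷_)))

disagree-≗ : ∀ {n} {f g : Point n → Bool} → f ≗ g → disagree f g ≡ 0
disagree-≗ {g = g} f≗g = trans (count-cong λ x → cong (_xor g x) (f≗g x)) (disagree-self g)

xor-triangle : ∀ u v w → (if u xor w then 1 else 0) ≤ (if u xor v then 1 else 0) + (if v xor w then 1 else 0)
xor-triangle false false _     = ≤-refl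
xor-triangle true  true  _     = ≤-refl
xor-triangle false true  false = z≤n
xor-triangle true  false true  = z≤n
xor-triangle false true  true  = s≤s z≤n
xor-triangle true  false false = s≤s z≤n

disagree-triangle : ∀ {n} (f g h : Point n → Bool) → disagree f h ≤ disagree f g + disagree g h
disagree-triangle {zero}  f g h = xor-triangle (f _) (g _) (h _)
disagree-triangle {suc n} f g h = ≤-trans
  (+-mono-≤ (disagree-triangle (f ∘ (false ∷_)) (g ∘ (false ∷_)) (h ∘ (false ∷_)))
            (disagree-triangle (f ∘ (true ∷_)) (g ∘ (true ∷_)) (h ∘ (true ∷_))))
  (≤-reflexive (+-interchange (disagree (f ∘ (false ∷_)) (g ∘ (false ∷_))) _
                              (disagree (f ∘ (true ∷_)) (g ∘ (true ∷_))) _))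

eval-extensional : ∀ {n} (T : DT n) → Extensional (eval T)
eval-extensional (leaf _)     _ = refl
eval-extensional (node i l r) {x} {y} x≗y rewrite x≗y i with y i
... | true  = eval-extensional r x≗y
... | false = eval-extensional l x≗y

Avoids : ∀ {n} → Fin n → DT n → Set
Avoids i (leaf _)     = ⊤
Avoids i (node j l r) = j ≢ i × Avoids i l × Avoids i r

Reduced : ∀ {n} → DT n → Set
Reduced (leaf _)     = ⊤
Reduced (node i l r) = Avoids i l × Avoids i r × Reduced l × Reduced r

eval-set-avoids : ∀ {n} {i : Fin n} (T : DT n) → Avoids i T → ∀ b x → eval T (set i b x) ≡ eval T x
eval-set-avoids (leaf _)     _                b x = refl
eval-set-avoids (node j l r) (j≢i , il , ir) b x rewrite set-≢ b x j≢i with x j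
... | true  = eval-set-avoids r ir b x
... | false = eval-set-avoids l il b x

eval-node-set : ∀ {n} {i : Fin n} {l r} → Avoids i l → Avoids i r →
                ∀ b x → eval (node i l r) (set i b x) ≡ eval (if b then r else l) x
eval-node-set {i = i} {l} {r} il ir b x rewrite set-≡ i b x with b
... | true  = eval-set-avoids r ir true x
... | false = eval-set-avoids l il false x

prune-children : ∀ {n} (i : Fin n) {l l′ r r′} → IsPruning l l′ → IsPruning r r′ →
                 IsPruning (node i l r) (node i l′ r′)
prune-children i {l′ = l′} {r} l⇒l′ r⇒r′ =
  gmap (λ t → node i t r) (inLeft i r) l⇒l′ ◅◅ gmap (node i l′) (inRight i l′) r⇒r′

avoids-step : ∀ {n} {i : Fin n} {T T′} → Avoids i T → PruneStep T T′ → Avoids i T′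
avoids-step (_   , il , ir) (toLeft _ _ _)  = il
avoids-step (_   , il , ir) (toRight _ _ _) = ir
avoids-step (j≢i , il , ir) (inLeft _ _ s)  = j≢i , avoids-step il s , ir
avoids-step (j≢i , il , ir) (inRight _ _ s) = j≢i , il , avoids-step ir s

avoids-pruning : ∀ {n} {i : Fin n} {T T′} → Avoids i T → IsPruning T T′ → Avoids i T′
avoids-pruning iT ε        = iT
avoids-pruning iT (s ◅ ss) = avoids-pruning (avoids-step iT s) ss

size-step : ∀ {n} {T T′ : DT n} → PruneStep T T′ → size T′ ≤ size T
size-step (toLeft _ l r)  = m≤m+n (size l) (size r)
size-step (toRight _ l r) = m≤n+m (size r) (size l)
size-step (inLeft _ r s)  = +-monoˡ-≤ (size r) (size-step s)
size-step (inRight _ l s) = +-monoʳ-≤ (size l) (size-step s)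

size-pruning : ∀ {n} {T T′ : DT n} → IsPruning T T′ → size T′ ≤ size T
size-pruning ε        = ≤-refl
size-pruning (s ◅ ss) = ≤-trans (size-pruning ss) (size-step s)

restrict : ∀ {n} → Fin n → Bool → DT n → DT n
restrict i b (leaf c) = leaf c
restrict i b (node j l r) with j ≟ i
... | yes _ = if b then restrict i b r else restrict i b l
... | no _  = node j (restrict i b l) (restrict i b r)

restrict-pruning : ∀ {n} (i : Fin n) b T → IsPruning T (restrict i b T)
restrict-pruning i b (leaf c) = ε
restrict-pruning i b (node j l r) with j ≟ i
... | no _ = prune-children j (restrict-pruning i b l) (restrict-pruning i b r)
... | yes _ with b
...   | true  = toRight j l r ◅ restrict-pruning i true r
...   | false = toLeft j l r ◅ restrict-pruning i false l

restrict-avoids : ∀ {n} (i : Fin n) b T → Avoids i (restrict i b T)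
restrict-avoids i b (leaf c) = tt
restrict-avoids i b (node j l r) with j ≟ i
... | no j≢i = j≢i , restrict-avoids i b l , restrict-avoids i b r
... | yes _ with b
...   | true  = restrict-avoids i true r
...   | false = restrict-avoids i false l

restrict-reduced : ∀ {n} (i : Fin n) b {T} → Reduced T → Reduced (restrict i b T)
restrict-reduced i b {leaf c} _ = tt
restrict-reduced i b {node j l r} (jl , jr , rl , rr) with j ≟ i
... | no _ = avoids-pruning jl (restrict-pruning i b l) , avoids-pruning jr (restrict-pruning i b r) ,
             restrict-reduced i b rl , restrict-reduced i b rr
... | yes _ with b
...   | true  = restrict-reduced i true rr
...   | false = restrict-reduced i false rl

eval-restrict : ∀ {n} (i : Fin n) b T x → eval (restrict i b T) x ≡ eval T (set i b x)
eval-restrict i b (leaf c) x = refl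
eval-restrict i b (node j l r) x with j ≟ i
... | no _ with x j
...   | true  = eval-restrict i b r x
...   | false = eval-restrict i b l x
eval-restrict i b (node j l r) x | yes refl with b
...   | true  = eval-restrict i true r x
...   | false = eval-restrict i false l x

reduce : ∀ {n} → DT n → DT n
reduce (leaf c)     = leaf c
reduce (node i l r) = node i (restrict i false (reduce l)) (restrict i true (reduce r))

reduce-pruning : ∀ {n} (T : DT n) → IsPruning T (reduce T)
reduce-pruning (leaf c)     = ε
reduce-pruning (node i l r) = prune-children i (reduce-pruning l ◅◅ restrict-pruning i false (reduce l))
                                               (reduce-pruning r ◅◅ restrict-pruning i true (reduce r))

reduce-reduced : ∀ {n} (T : DT n) → Reduced (reduce T)
reduce-reduced (leaf c)     = tt
reduce-reduced (node i l r) =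
  restrict-avoids i false (reduce l) , restrict-avoids i true (reduce r) ,
  restrict-reduced i false (reduce-reduced l) , restrict-reduced i true (reduce-reduced r)

eval-reduce : ∀ {n} (T : DT n) x → eval (reduce T) x ≡ eval T x
eval-reduce (leaf c)     x = refl
eval-reduce (node i l r) x with x i in xᵢ≡b
... | true  = trans (eval-restrict i true (reduce r) x)
                    (trans (eval-reduce r _) (eval-extensional r (set-self i xᵢ≡b)))
... | false = trans (eval-restrict i false (reduce l) x)
                    (trans (eval-reduce l _) (eval-extensional l (set-self i xᵢ≡b)))

disagree-node-split : ∀ {n} {g : Point n → Bool} → Extensional g → ∀ {i l r} → Avoids i l → Avoids i r →
  disagree g (eval (node i l r)) + disagree g (eval (node i l r))
    ≡ disagree (g ∘ set i false) (eval l) + disagree (g ∘ set i true) (eval r)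
disagree-node-split {g = g} E {i} {l} {r} il ir = trans
  (sym (count-set-split (xor-extensional E (eval-extensional (node i l r))) i))
  (cong₂ _+_ (count-cong λ x → cong (g (set i false x) xor_) (eval-node-set il ir false x))
             (count-cong λ x → cong (g (set i true x) xor_) (eval-node-set il ir true x)))

influenceCount : ∀ {n} → (Point n → Bool) → Fin n → ℕ
influenceCount g i = disagree g (g ∘ set i false) + disagree g (g ∘ set i true)

disagree-children : ∀ {n} {g : Point n → Bool} → Extensional g → ∀ {i l r} → Avoids i l → Avoids i r →
  disagree g (eval l) + disagree g (eval r)
    ≤ influenceCount g i + (disagree g (eval (node i l r)) + disagree g (eval (node i l r)))
disagree-children {g = g} E {i} {l} {r} il ir = begin
  disagree g (eval l) + disagree g (eval r)
    ≤⟨ +-mono-≤ (disagree-triangle g g₀ (eval l)) (disagree-triangle g g₁ (eval r)) ⟩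
  (disagree g g₀ + disagree g₀ (eval l)) + (disagree g g₁ + disagree g₁ (eval r))
    ≡⟨ +-interchange (disagree g g₀) (disagree g₀ (eval l)) (disagree g g₁) (disagree g₁ (eval r)) ⟩
  influenceCount g i + (disagree g₀ (eval l) + disagree g₁ (eval r))
    ≡⟨ cong (_+_ (influenceCount g i)) (sym (disagree-node-split E il ir)) ⟩
  influenceCount g i + (disagree g (eval (node i l r)) + disagree g (eval (node i l r))) ∎
  where
  open ≤-Reasoning
  g₀ = g ∘ set i false
  g₁ = g ∘ set i true

InfAbove-∘ : ∀ {n} {τ} (g : Point n → Bool) (ρ σ : Point n → Point n) T →
             InfAbove τ (g ∘ ρ) σ T → InfAbove τ g (ρ ∘ σ) T
InfAbove-∘ g ρ σ (leaf _)     _               = tt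
InfAbove-∘ g ρ σ (node i l r) (τ≤Inf , il , ir) =
  τ≤Inf , InfAbove-∘ g ρ (σ ∘ set i false) l il , InfAbove-∘ g ρ (σ ∘ set i true) r ir

-- With τ = a/b and K = 2ⁿ·a, an error bound  e⋆ ≤ e + τ·2ⁿ·log₂ s  between error counts is,
-- free of logarithms,  2 ^ (e⋆ * b) ≤ weight e s.
module Weight (b K : ℕ) where

  weight : ℕ → ℕ → ℕ
  weight e s = 2 ^ (e * b) * s ^ K

  2^-distrib : ∀ e e′ → 2 ^ ((e + e′) * b) ≡ 2 ^ (e * b) * 2 ^ (e′ * b)
  2^-distrib e e′ = trans (cong (2 ^_) (*-distribʳ-+ b e e′)) (^-distribˡ-+-* 2 (e * b) (e′ * b))

  weight-* : ∀ e e′ s s′ → weight e s * weight e′ s′ ≡ 2 ^ ((e + e′) * b) * (s * s′) ^ K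
  weight-* e e′ s s′ = trans (*-interchange (2 ^ (e * b)) (s ^ K) (2 ^ (e′ * b)) (s′ ^ K))
                             (sym (cong₂ _*_ (2^-distrib e e′) (^-distribʳ-* s s′ K)))

  -- A record rather than a synonym so that Agda can infer e⋆ and e, which occur only inside
  -- 2 ^ (_ * b), where unification gets stuck.
  record ErrorBound (e⋆ e s : ℕ) : Set where
    constructor errorBound
    field bound : 2 ^ (e⋆ * b) ≤ weight e s

  errorBound-leaf : ∀ e → ErrorBound e e 1
  errorBound-leaf e =
    errorBound (≤-reflexive (sym (trans (cong (2 ^ (e * b) *_) (^-zeroˡ K)) (*-identityʳ _))))

  errorBound-average : ∀ {e e₀ e₁ D D₀ D₁ s₀ s₁} → e + e ≡ e₀ + e₁ → D + D ≡ D₀ + D₁ →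
                       ErrorBound e₀ D₀ s₀ → ErrorBound e₁ D₁ s₁ → ErrorBound e D (s₀ + s₁)
  errorBound-average {e} {e₀} {e₁} {D} {D₀} {D₁} {s₀} {s₁} ee≡e₀e₁ DD≡D₀D₁
                     (errorBound e₀≤) (errorBound e₁≤) = errorBound (m*m≤n*n⇒m≤n (begin
    2 ^ (e * b) * 2 ^ (e * b)               ≡⟨ sym (2^-distrib e e) ⟩
    2 ^ ((e + e) * b)                       ≡⟨ cong (λ x → 2 ^ (x * b)) ee≡e₀e₁ ⟩
    2 ^ ((e₀ + e₁) * b)                     ≡⟨ 2^-distrib e₀ e₁ ⟩
    2 ^ (e₀ * b) * 2 ^ (e₁ * b)             ≤⟨ *-mono-≤ e₀≤ e₁≤ ⟩
    weight D₀ s₀ * weight D₁ s₁             ≡⟨ weight-* D₀ D₁ s₀ s₁ ⟩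
    2 ^ ((D₀ + D₁) * b) * (s₀ * s₁) ^ K     ≡⟨ cong (λ x → 2 ^ (x * b) * (s₀ * s₁) ^ K) (sym DD≡D₀D₁) ⟩
    2 ^ ((D + D) * b) * (s₀ * s₁) ^ K
      ≤⟨ *-monoʳ-≤ (2 ^ ((D + D) * b)) (^-monoˡ-≤ K (*-mono-≤ (m≤m+n s₀ s₁) (m≤n+m s₁ s₀))) ⟩
    2 ^ ((D + D) * b) * ((s₀ + s₁) * (s₀ + s₁)) ^ K ≡⟨ sym (weight-* D D (s₀ + s₁) (s₀ + s₁)) ⟩
    weight D (s₀ + s₁) * weight D (s₀ + s₁) ∎))
    where open ≤-Reasoning

  weight-children : ∀ A₀ A₁ S D s₀ s₁ → A₀ + A₁ ≤ S + (D + D) → S * b ≤ 2 * K →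
                    weight A₀ s₀ * weight A₁ s₁ ≤ weight D (s₀ + s₁) * weight D (s₀ + s₁)
  weight-children A₀ A₁ S D s₀ s₁ A≤S+2D Sb≤2K = begin
    weight A₀ s₀ * weight A₁ s₁                           ≡⟨ weight-* A₀ A₁ s₀ s₁ ⟩
    2 ^ ((A₀ + A₁) * b) * (s₀ * s₁) ^ K                   ≤⟨ *-monoˡ-≤ _ (^-monoʳ-≤ 2 (*-monoˡ-≤ b A≤S+2D)) ⟩
    2 ^ ((S + (D + D)) * b) * (s₀ * s₁) ^ K               ≡⟨ cong (_* (s₀ * s₁) ^ K) (2^-distrib S (D + D)) ⟩
    2 ^ (S * b) * 2 ^ ((D + D) * b) * (s₀ * s₁) ^ K       ≤⟨ *-monoˡ-≤ _ (*-monoˡ-≤ _ (^-monoʳ-≤ 2 Sb≤2K)) ⟩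
    2 ^ (2 * K) * 2 ^ ((D + D) * b) * (s₀ * s₁) ^ K
      ≡⟨ cong (λ x → x * 2 ^ ((D + D) * b) * (s₀ * s₁) ^ K) (sym (^-*-assoc 2 2 K)) ⟩
    4 ^ K * 2 ^ ((D + D) * b) * (s₀ * s₁) ^ K             ≡⟨ *-xy∙z≈y∙xz (4 ^ K) _ _ ⟩
    2 ^ ((D + D) * b) * (4 ^ K * (s₀ * s₁) ^ K)
      ≡⟨ cong (2 ^ ((D + D) * b) *_) (sym (^-distribʳ-* 4 (s₀ * s₁) K)) ⟩
    2 ^ ((D + D) * b) * (4 * (s₀ * s₁)) ^ K
      ≤⟨ *-monoʳ-≤ (2 ^ ((D + D) * b)) (^-monoˡ-≤ K (am-gm s₀ s₁)) ⟩
    2 ^ ((D + D) * b) * ((s₀ + s₁) * (s₀ + s₁)) ^ K       ≡⟨ sym (weight-* D D (s₀ + s₁) (s₀ + s₁)) ⟩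
    weight D (s₀ + s₁) * weight D (s₀ + s₁) ∎
    where open ≤-Reasoning

  errorBound-children : ∀ {e₀ e₁ A₀ A₁ s₀ s₁} S D → A₀ + A₁ ≤ S + (D + D) → S * b ≤ 2 * K →
                        ErrorBound e₀ A₀ s₀ → ErrorBound e₁ A₁ s₁ →
                        ErrorBound e₀ D (s₀ + s₁) ⊎ ErrorBound e₁ D (s₀ + s₁)
  errorBound-children {A₀ = A₀} {A₁} {s₀} {s₁} S D A≤S+2D Sb≤2K (errorBound e₀≤) (errorBound e₁≤)
    with m*n≤o*o⇒m≤o⊎n≤o (weight-children A₀ A₁ S D s₀ s₁ A≤S+2D Sb≤2K)
  ... | inj₁ w₀≤ = inj₁ (errorBound (≤-trans e₀≤ w₀≤))
  ... | inj₂ w₁≤ = inj₂ (errorBound (≤-trans e₁≤ w₁≤))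

module _ {n : ℕ} (τ : ℚ) .{{_ : Positive τ}} where

  open Weight (↧ₙ τ) (2 ^ n * ∣ ↥ τ ∣)

  record InfluentialPruning (g : Point n → Bool) (T : DT n) : Set where
    constructor pruned
    field
      T⋆          : DT n
      T⇒T⋆        : IsPruning T T⋆
      influential : InfAbove τ g id T⋆
      error-bound : ErrorBound (disagree g (eval T⋆)) (disagree g (eval T)) (size T)

  Inf<τ⇒influenceCount≤ : ∀ {g : Point n → Bool} {i} → Inf g i <ℚ τ →
                          influenceCount g i * ↧ₙ τ ≤ 2 * (2 ^ n * ∣ ↥ τ ∣)
  Inf<τ⇒influenceCount≤ {g} {i} Inf<τ = begin
    influenceCount g i * ↧ₙ τ
      ≤⟨ <⇒≤ (+m/n<p⇒m*↧p<∣↥p∣*n (influenceCount g i) (2 ^ suc n) {{m^n≢0 2 (suc n)}} Inf<τ) ⟩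
    ∣ ↥ τ ∣ * 2 ^ suc n     ≡⟨ *-comm ∣ ↥ τ ∣ (2 ^ suc n) ⟩
    2 * 2 ^ n * ∣ ↥ τ ∣     ≡⟨ *-assoc 2 (2 ^ n) ∣ ↥ τ ∣ ⟩
    2 * (2 ^ n * ∣ ↥ τ ∣) ∎
    where open ≤-Reasoning

  keep-node : ∀ {g : Point n → Bool} {i l r} → Extensional g → Avoids i l → Avoids i r → τ ≤ℚ Inf g i →
              InfluentialPruning (g ∘ set i false) l → InfluentialPruning (g ∘ set i true) r →
              InfluentialPruning g (node i l r)
  keep-node {g} {i} E il ir τ≤Inf (pruned l⋆ l⇒l⋆ infₗ boundₗ) (pruned r⋆ r⇒r⋆ infᵣ boundᵣ) =
    pruned (node i l⋆ r⋆) (prune-children i l⇒l⋆ r⇒r⋆)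
      (τ≤Inf , InfAbove-∘ g (set i false) id l⋆ infₗ , InfAbove-∘ g (set i true) id r⋆ infᵣ)
      (errorBound-average (disagree-node-split E (avoids-pruning il l⇒l⋆) (avoids-pruning ir r⇒r⋆))
                          (disagree-node-split E il ir) boundₗ boundᵣ)

  replace-node : ∀ {g : Point n → Bool} {i l r} → Extensional g → Avoids i l → Avoids i r → Inf g i <ℚ τ →
                 InfluentialPruning g l → InfluentialPruning g r → InfluentialPruning g (node i l r)
  replace-node {g} {i} {l} {r} E il ir Inf<τ (pruned l⋆ l⇒l⋆ infₗ boundₗ) (pruned r⋆ r⇒r⋆ infᵣ boundᵣ)
    with errorBound-children (influenceCount g i) (disagree g (eval (node i l r)))
           (disagree-children E il ir) (Inf<τ⇒influenceCount≤ {g} {i} Inf<τ) boundₗ boundᵣ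
  ... | inj₁ boundₗ′ = pruned l⋆ (toLeft i l r ◅ l⇒l⋆) infₗ boundₗ′
  ... | inj₂ boundᵣ′ = pruned r⋆ (toRight i l r ◅ r⇒r⋆) infᵣ boundᵣ′

  influential-pruning : ∀ {g : Point n → Bool} → Extensional g → ∀ T → Reduced T → InfluentialPruning g T
  influential-pruning E (leaf c) _ = pruned (leaf c) ε tt (errorBound-leaf _)
  influential-pruning {g} E (node i l r) (il , ir , redₗ , redᵣ) with τ ≤ℚ? Inf g i
  ... | yes τ≤Inf = keep-node E il ir τ≤Inf (influential-pruning (∘set-extensional E i false) l redₗ)
                                            (influential-pruning (∘set-extensional E i true) r redᵣ)
  ... | no τ≰Inf  = replace-node E il ir (≰⇒>ℚ τ≰Inf) (influential-pruning E l redₗ)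
                                                       (influential-pruning E r redᵣ)

theorem4 : (n : ℕ) (f : Point n → Bool) (T : DT n) → (∀ x → eval T x ≡ f x)
           → (τ : ℚ) → Positive τ
           → Σ (DT n) (λ T⋆ → IsPruning T T⋆
               × ErrorAtMostTauLog n (disagree f (eval T⋆)) τ (size T)
               × InfAbove τ f (λ x → x) T⋆)
theorem4 n f T T≗f τ τ>0 = T⋆ , reduce-pruning T ◅◅ T⇒T⋆ , error-at-most-τ-log , influential
  where
  K = 2 ^ n * ∣ ↥ τ ∣
  open Weight (↧ₙ τ) K
  f-extensional : Extensional f
  f-extensional {x} {y} x≗y = trans (sym (T≗f x)) (trans (eval-extensional T x≗y) (T≗f y))
  open InfluentialPruning {{τ>0}} (influential-pruning τ {{τ>0}} f-extensional (reduce T) (reduce-reduced T))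
  error-at-most-τ-log : ErrorAtMostTauLog n (disagree f (eval T⋆)) τ (size T)
  error-at-most-τ-log = begin
    2 ^ (disagree f (eval T⋆) * ↧ₙ τ)                  ≤⟨ ErrorBound.bound error-bound ⟩
    weight (disagree f (eval (reduce T))) (size (reduce T))
      ≡⟨ cong (λ e → weight e (size (reduce T))) (disagree-≗ λ x → sym (trans (eval-reduce T x) (T≗f x))) ⟩
    1 * size (reduce T) ^ K                            ≡⟨ *-identityˡ _ ⟩
    size (reduce T) ^ K                                ≤⟨ ^-monoˡ-≤ K (size-pruning (reduce-pruning T)) ⟩
    size T ^ K ∎
    where open ≤-Reasoning
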